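{- Let $A=(A(1),\ldots,A(n))$ be an array of elements of a totally ordered set that is both $3$-sorted and $4$-sorted. If $(i,i+p)$ and $(i+p,i+p+q)$ are both inversions of $A$ (with $p,q\ge1$), then $p=q=1$. Furthermore, $(i,i+1)$, $(i+1,i+2)$ and $(i+2,i+3)$ cannot all be inversions of $A$.
   Context: An array $A$ is $k$-sorted if $A(i)\le A(i+k)$ for all $1\le i\le n-k$. An inversion of $A$ is a pair $(i,j)$ with $1\le i<j\le n$ and $A(i)>A(j)$. -}

module Defs where

open import Level using (Level)
open import Data.Nat using (ℕ; _+_)
import Data.Nat as ℕ
open import Data.Fin using (Fin; toℕ)
open import Data.Product using (_×_)
open import Relation.Binary.PropositionalEquality using (_≡_)
open import Relation.Binary.Bundles using (TotalOrder)
import Relation.Binary.Construct.NonStrictToStrict as NS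

-- Arrays of length n are functions Fin n → Carrier (positions are 0-indexed,
-- which is just a shift of the paper's 1-indexed positions).
module _ {c ℓ₁ ℓ₂ : Level} (O : TotalOrder c ℓ₁ ℓ₂) where
  open TotalOrder O renaming (Carrier to X)

  _<ₒ_ : X → X → Set _
  _<ₒ_ = NS._<_ _≈_ _≤_

  KSorted : {n : ℕ} → ℕ → (Fin n → X) → Set _
  KSorted {n} k A = (i j : Fin n) → toℕ j ≡ toℕ i + k → A i ≤ A j

  Inversion : {n : ℕ} → (Fin n → X) → Fin n → Fin n → Set _
  Inversion A i j = (toℕ i ℕ.< toℕ j) × (A j <ₒ A i)

{-# OPTIONS --safe #-}
-- Being a-sorted and b-sorted implies being (a + b)-sorted, so A is d-sorted for
-- every d in the numerical semigroup generated by 3 and 4, whose only positive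
-- gaps are 1, 2 and 5; hence every inversion spans a distance 1, 2 or 5.
-- Inversions compose, so in the first part p, q and p + q are all gaps, which
-- forces p = q = 1; in the second part the three inversions compose to one of
-- distance 3.
module Submission where

open import Defs
open import Level using (Level)
open import Data.Nat using (ℕ; zero; suc; _+_; _≥_)
import Data.Nat as ℕ
open import Data.Nat.Properties using (+-assoc; +-identityʳ; +-monoʳ-≤; m≤m+n; ≤-<-trans; <-irrefl)
  renaming (<-trans to <-transℕ)
open import Data.Fin using (Fin; toℕ; fromℕ<)
open import Data.Fin.Properties using (toℕ<n; toℕ-fromℕ<)
open import Data.Product using (_×_; _,_)
open import Data.Empty using (⊥-elim)
open import Relation.Nullary using (¬_)
open import Relation.Binary.PropositionalEquality using (_≡_; refl; sym; trans; cong; subst; module ≡-Reasoning)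
open import Relation.Binary.Bundles using (TotalOrder)
import Relation.Binary.Construct.NonStrictToStrict as NS

data Generated (a b : ℕ) : ℕ → Set where
  gen-a : Generated a b a
  gen-b : Generated a b b
  gen-+ : ∀ {d e} → Generated a b d → Generated a b e → Generated a b (d + e)

6+m∈⟨3,4⟩ : ∀ m → Generated 3 4 (6 + m)
6+m∈⟨3,4⟩ zero                = gen-+ gen-a gen-a
6+m∈⟨3,4⟩ (suc zero)          = gen-+ gen-a gen-b
6+m∈⟨3,4⟩ (suc (suc zero))    = gen-+ gen-b gen-b
6+m∈⟨3,4⟩ (suc (suc (suc m))) = gen-+ gen-a (6+m∈⟨3,4⟩ m)

data Gap₃₄ : ℕ → Set where
  gap-1 : Gap₃₄ 1
  gap-2 : Gap₃₄ 2
  gap-5 : Gap₃₄ 5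

Gap₃₄-sum⇒≡1 : ∀ {p q} → Gap₃₄ p → Gap₃₄ q → Gap₃₄ (p + q) → (p ≡ 1) × (q ≡ 1)
Gap₃₄-sum⇒≡1 gap-1 gap-1 _  = refl , refl
Gap₃₄-sum⇒≡1 gap-1 gap-2 ()
Gap₃₄-sum⇒≡1 gap-1 gap-5 ()
Gap₃₄-sum⇒≡1 gap-2 gap-1 ()
Gap₃₄-sum⇒≡1 gap-2 gap-2 ()
Gap₃₄-sum⇒≡1 gap-2 gap-5 ()
Gap₃₄-sum⇒≡1 gap-5 gap-1 ()
Gap₃₄-sum⇒≡1 gap-5 gap-2 ()
Gap₃₄-sum⇒≡1 gap-5 gap-5 ()

module _ {c ℓ₁ ℓ₂ : Level} (O : TotalOrder c ℓ₁ ℓ₂) where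
  open TotalOrder O using (_≈_; _≤_; antisym; isPartialOrder)
    renaming (Carrier to X; trans to ≤-trans)

  private
    variable
      n a b d : ℕ
      A : Fin n → X
      i j k : Fin n

  KSorted-+ : KSorted O a A → KSorted O b A → KSorted O (a + b) A
  KSorted-+ {a = a} {b = b} sortedᵃ sortedᵇ i j j≡i+[a+b] =
    ≤-trans (sortedᵃ i m m≡i+a) (sortedᵇ m j j≡m+b)
    where
    i+a<n : toℕ i + a ℕ.< _
    i+a<n = ≤-<-trans (+-monoʳ-≤ (toℕ i) (m≤m+n a b)) (subst (ℕ._< _) j≡i+[a+b] (toℕ<n j))
    m = fromℕ< i+a<n
    m≡i+a : toℕ m ≡ toℕ i + a
    m≡i+a = toℕ-fromℕ< i+a<n
    j≡m+b : toℕ j ≡ toℕ m + b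
    j≡m+b = begin
      toℕ j            ≡⟨ j≡i+[a+b] ⟩
      toℕ i + (a + b)  ≡⟨ sym (+-assoc (toℕ i) a b) ⟩
      toℕ i + a + b    ≡⟨ cong (_+ b) (sym m≡i+a) ⟩
      toℕ m + b        ∎
      where open ≡-Reasoning

  KSorted-generated : KSorted O a A → KSorted O b A → Generated a b d → KSorted O d A
  KSorted-generated sortedᵃ sortedᵇ gen-a       = sortedᵃ
  KSorted-generated sortedᵃ sortedᵇ gen-b       = sortedᵇ
  KSorted-generated sortedᵃ sortedᵇ (gen-+ g h) =
    KSorted-+ (KSorted-generated sortedᵃ sortedᵇ g) (KSorted-generated sortedᵃ sortedᵇ h)

  KSorted⇒¬Inversion : KSorted O d A → toℕ j ≡ toℕ i + d → ¬ Inversion O A i j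
  KSorted⇒¬Inversion sorted j≡i+d (_ , Aj<Ai) = NS.<⇒≱ _≈_ _≤_ antisym Aj<Ai (sorted _ _ j≡i+d)

  Inversion-trans : Inversion O A i j → Inversion O A j k → Inversion O A i k
  Inversion-trans (i<j , Aj<Ai) (j<k , Ak<Aj) =
    <-transℕ i<j j<k , NS.<-trans _≈_ _≤_ isPartialOrder Ak<Aj Aj<Ai

  Inversion⇒Gap₃₄ : KSorted O 3 A → KSorted O 4 A →
                    ∀ d → toℕ j ≡ toℕ i + d → Inversion O A i j → Gap₃₄ d
  Inversion⇒Gap₃₄ _ _ 0 j≡i+0 (i<j , _) =
    ⊥-elim (<-irrefl (sym (trans j≡i+0 (+-identityʳ _))) i<j)
  Inversion⇒Gap₃₄ _ _ 1 _ _ = gap-1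
  Inversion⇒Gap₃₄ _ _ 2 _ _ = gap-2
  Inversion⇒Gap₃₄ _ _ 5 _ _ = gap-5
  Inversion⇒Gap₃₄ s₃ s₄ 3 j≡i+d inv = ⊥-elim (KSorted⇒¬Inversion s₃ j≡i+d inv)
  Inversion⇒Gap₃₄ s₃ s₄ 4 j≡i+d inv = ⊥-elim (KSorted⇒¬Inversion s₄ j≡i+d inv)
  Inversion⇒Gap₃₄ s₃ s₄ (suc (suc (suc (suc (suc (suc m)))))) j≡i+d inv =
    ⊥-elim (KSorted⇒¬Inversion (KSorted-generated s₃ s₄ (6+m∈⟨3,4⟩ m)) j≡i+d inv)

lemma8 : {c ℓ₁ ℓ₂ : Level} (O : TotalOrder c ℓ₁ ℓ₂) (n : ℕ)
         (A : Fin n → TotalOrder.Carrier O) →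
         KSorted O 3 A → KSorted O 4 A →
         ((p q : ℕ) (i j k : Fin n) → p ≥ 1 → q ≥ 1 →
           toℕ j ≡ toℕ i + p → toℕ k ≡ toℕ j + q →
           Inversion O A i j → Inversion O A j k → (p ≡ 1) × (q ≡ 1))
         ×
         ((i j k l : Fin n) →
           toℕ j ≡ toℕ i + 1 → toℕ k ≡ toℕ i + 2 → toℕ l ≡ toℕ i + 3 →
           ¬ (Inversion O A i j × Inversion O A j k × Inversion O A k l))
lemma8 O n A s₃ s₄ = consecutive-inversions , no-three-adjacent-inversions
  where
  consecutive-inversions : (p q : ℕ) (i j k : Fin n) → p ≥ 1 → q ≥ 1 →
    toℕ j ≡ toℕ i + p → toℕ k ≡ toℕ j + q →
    Inversion O A i j → Inversion O A j k → (p ≡ 1) × (q ≡ 1)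
  consecutive-inversions p q i j k _ _ j≡i+p k≡j+q ij jk =
    Gap₃₄-sum⇒≡1 (Inversion⇒Gap₃₄ O s₃ s₄ p j≡i+p ij)
                 (Inversion⇒Gap₃₄ O s₃ s₄ q k≡j+q jk)
                 (Inversion⇒Gap₃₄ O s₃ s₄ (p + q) k≡i+[p+q] (Inversion-trans O ij jk))
    where
    k≡i+[p+q] : toℕ k ≡ toℕ i + (p + q)
    k≡i+[p+q] = trans k≡j+q (trans (cong (_+ q) j≡i+p) (+-assoc (toℕ i) p q))

  no-three-adjacent-inversions : (i j k l : Fin n) →
    toℕ j ≡ toℕ i + 1 → toℕ k ≡ toℕ i + 2 → toℕ l ≡ toℕ i + 3 →
    ¬ (Inversion O A i j × Inversion O A j k × Inversion O A k l)
  no-three-adjacent-inversions i j k l _ _ l≡i+3 (ij , jk , kl) =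
    KSorted⇒¬Inversion O s₃ l≡i+3 (Inversion-trans O (Inversion-trans O ij jk) kl)
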